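{- Let $P$ be a finite poset, $n\ge 2$, and run the (non-induced) greedy colex process for $P$ on ground set $[n]$, producing families $\mathcal F_0\subseteq\mathcal F_1\subseteq\dots\subseteq\mathcal F_{2^{n-1}}$. For every $2\le i\le 2^{n-1}$, with $m_i=\max F_i$: (1) if $F_i\in\mathcal F_i$ then $F_i\setminus\{m_i\}\in\mathcal F_j$ for some $j<i$; (2) if $F_i\in\mathcal F_i$ then $F_i\cup([n]\setminus[m_i])\in\mathcal F_j$ for some $j<i$; (3) if $G_i\in\mathcal F_i$ then $G_i\cup\{m_i\}\in\mathcal F_j$ for some $j<i$; (4) if $G_i\in\mathcal F_i$ then $G_i\cap[m_i]\in\mathcal F_j$ for some $j<i$.
   Context: A subfamily $\mathcal G\subseteq\mathcal F\subseteq 2^{[n]}$ is a non-induced copy of a poset $P$ if there is a bijection $i:P\to\mathcal G$ such that $p\le_P q$ implies $i(p)\subseteq i(q)$; $\mathcal F$ is $P$-free if it contains no non-induced copy of $P$. The colex order on finite subsets of positive integers: $A<B$ iff $\max(A\triangle B)\in B$. Let $F_1,F_2,\dots,F_{2^{n-1}}$ enumerate $2^{[n-1]}$ in colex order (so $F_1=\emptyset$) and let $G_i=[n]\setminus F_i$. The greedy colex process: set $\mathcal F_0=\emptyset$; for $i=0,1,\dots,2^{n-1}-1$, let $\mathcal F_i'=\mathcal F_i\cup\{F_{i+1}\}$ if this family is $P$-free and $\mathcal F_i'=\mathcal F_i$ otherwise; then let $\mathcal F_{i+1}=\mathcal F_i'\cup\{G_{i+1}\}$ if this family is $P$-free and $\mathcal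 F_{i+1}=\mathcal F_i'$ otherwise. -}

module Defs where

open import Data.Nat using (ℕ; zero; suc; _≤_; _<_; _^_; _∸_; _<ᵇ_)
open import Data.Fin using (Fin; toℕ) renaming (_≤_ to _≤ᶠ_; _<_ to _<ᶠ_)
open import Data.Fin.Subset using (Subset; _∈_; _∉_; _⊆_; _∪_; ∁)
open import Data.Bool using (Bool; _xor_)
open import Data.Vec using (Vec; zipWith; tabulate)
open import Data.List using (List; []; _∷_)
open import Data.List.Membership.Propositional using () renaming (_∈_ to _∈ᶠ_)
open import Data.Product using (Σ; ∃; _×_)
open import Data.Sum using (_⊎_)
open import Relation.Nullary using (¬_)
open import Relation.Binary.PropositionalEquality using (_≡_)
open import Function.Bundles using (_⇔_)

-- Subsets of [n] = {1,…,n} are represented as 'Subset n'; the index x : Fin n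
-- stands for the positive integer (toℕ x + 1).

_△_ : ∀ {n} → Subset n → Subset n → Subset n
A △ B = zipWith _xor_ A B

IsMax : ∀ {n} → Subset n → Fin n → Set
IsMax S x = x ∈ S × (∀ y → y ∈ S → y ≤ᶠ x)

ColexLt : ∀ {n} → Subset n → Subset n → Set
ColexLt A B = Σ _ λ x → IsMax (A △ B) x × x ∈ B

-- [m] = {1,…,m} as a subset of [n]  (element toℕ x + 1 ≤ m  iff  toℕ x < m)
upto : ∀ n → ℕ → Subset n
upto n m = tabulate λ (x : Fin n) → toℕ x <ᵇ m

-- S ⊆ [n-1], i.e. the element n is not in S
AvoidsTop : ∀ {n} → Subset n → Set
AvoidsTop {n} S = ∀ (x : Fin n) → suc (toℕ x) ≡ n → x ∉ S

-- number of subsets of [n-1]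
half : ℕ → ℕ
half n = 2 ^ (n ∸ 1)

-- F 1, F 2, …, F (2^(n-1)) enumerate 2^[n-1] in colex order
-- (values of F outside the index range 1..2^(n-1) are irrelevant)
IsColexEnum : ∀ n → (ℕ → Subset n) → Set
IsColexEnum n F =
  (∀ i → 1 ≤ i → i ≤ half n → AvoidsTop (F i))
  × (∀ i j → 1 ≤ i → i < j → j ≤ half n → ColexLt (F i) (F j))
  × (∀ S → AvoidsTop S → ∃ λ i → 1 ≤ i × i ≤ half n × F i ≡ S)

compl : ∀ {n} → (ℕ → Subset n) → ℕ → Subset n
compl F i = ∁ (F i)

-- A non-induced copy of P in the family 𝓕 (a list of subsets, read as a set):
-- an injective map ι from P into 𝓕 with p ≤P q ⇒ ι p ⊆ ι q
-- (equivalently a bijection from P onto the subfamily given by its image).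
Copy : ∀ {k n} → (Fin k → Fin k → Set) → List (Subset n) → Set
Copy {k} {n} _≤P_ 𝓕 = Σ (Fin k → Subset n) λ ι →
  (∀ p → ι p ∈ᶠ 𝓕)
  × (∀ p q → ι p ≡ ι q → p ≡ q)
  × (∀ p q → p ≤P q → ι p ⊆ ι q)

Free : ∀ {k n} → (Fin k → Fin k → Set) → List (Subset n) → Set
Free _≤P_ 𝓕 = ¬ Copy _≤P_ 𝓕

Step : ∀ {k n} → (Fin k → Fin k → Set) → List (Subset n) → Subset n → List (Subset n) → Set
Step _≤P_ 𝓐 S 𝓑 =
  (Free _≤P_ (S ∷ 𝓐) × 𝓑 ≡ S ∷ 𝓐) ⊎ (¬ Free _≤P_ (S ∷ 𝓐) × 𝓑 ≡ 𝓐)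

GreedyColex : ∀ {k n} → (Fin k → Fin k → Set) → (ℕ → Subset n) → (ℕ → List (Subset n)) → Set
GreedyColex {n = n} _≤P_ F fam =
  fam 0 ≡ []
  × (∀ i → i < half n → Σ (List (Subset n)) λ 𝓕′ →
       Step _≤P_ (fam i) (F (suc i)) 𝓕′ × Step _≤P_ 𝓕′ (compl F (suc i)) (fam (suc i)))

-- Each of the four sets T is a set F j or G j with j < i: it is F i - m or G i ∩ [m]
-- (or the complement of one of these), and both sets precede F i in colex order because
-- they lie in [m] and miss m = max F i.  If T had been rejected at its turn, some copy of
-- P would have used T together with sets added before it; replacing T by the set S ∈
-- {F i, G i} the lemma starts from gives a copy of P using S and sets present when S was
-- tested, contradicting that S was accepted.  The replacement is legitimate because every
-- set present before T's turn that is comparable with T is comparable with S in the same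
-- direction, which follows from the colex order of the enumeration.
module Submission where

open import Defs
open import Data.Nat using (ℕ; zero; suc; _≤_; _<_; z≤n; s≤s)
open import Data.Nat.Properties
  using (≤-refl; ≤-trans; ≤-antisym; ≤-pred; <⇒≤; <⇒≢; ≤-<-trans; ≤∧≢⇒<; <-cmp;
         m≤n⇒m≤1+n; m≤n⇒m<n∨m≡n; <-irrefl; <ᵇ⇒<; <⇒<ᵇ)
open import Data.Bool using (true; false) renaming (_≟_ to _≟ᵇ_)
open import Data.Bool.Properties using (xor-comm; T-≡)
open import Data.Fin using (Fin; toℕ; fromℕ) renaming (_≟_ to _≟ᶠ_)
open import Data.Fin.Properties using (toℕ-injective; toℕ<n; toℕ-fromℕ)
open import Data.Fin.Subset using (Subset; _∈_; _∉_; _⊆_; _∪_; _∩_; _─_; _-_; ⁅_⁆; ∁)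
open import Data.Fin.Subset.Properties
  using (_∈?_; ⊆-refl; ⊆-reflexive; ⊆-trans; x∈⁅x⁆; x∈⁅y⁆⇒x≡y; x∈∁p⇒x∉p; x∉p⇒x∈∁p;
         ∁p⊆∁q⇒p⊇q; p⊆p∪q; q⊆p∪q; x∈p∪q⁻; p∩q⊆p; p∩q⊆q; x∈p∩q⁺; p─q⊆p;
         x∈p∧x≢y⇒x∈p-y; ∪-∩-booleanAlgebra)
open import Algebra.Lattice.Properties.BooleanAlgebra as BooleanAlgebra using ()
open import Data.Vec using (_∷_; []; here; there)
open import Data.Vec.Properties using (zipWith-comm; []=⇒lookup; lookup⇒[]=; lookup∘tabulate; ≡-dec)
open import Data.List using (List; []; _∷_)
open import Data.List.Membership.Propositional using () renaming (_∈_ to _∈ᶠ_; _∉_ to _∉ᶠ_)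
open import Data.List.Relation.Binary.Subset.Propositional using () renaming (_⊆_ to _⊆ᶠ_)
open import Data.List.Relation.Unary.Any using (here; there)
open import Data.Product using (Σ; ∃; _×_; _,_; proj₁; proj₂)
open import Data.Sum using (_⊎_; inj₁; inj₂)
open import Data.Empty using (⊥-elim)
open import Function using (_∘_; Equivalence)
open import Relation.Nullary using (¬_; Dec; yes; no)
open import Relation.Binary.PropositionalEquality using (_≡_; _≢_; refl; sym; trans; cong; subst; module ≡-Reasoning)
open import Relation.Binary.Structures using (IsPartialOrder)
open import Relation.Binary.Definitions using (tri<; tri≈; tri>)

private
  variable
    n : ℕ
    x m : Fin n
    A B : Subset n

x∈p△q⁻ : ∀ (p q : Subset n) → x ∈ p △ q → (x ∈ p × x ∉ q) ⊎ (x ∉ p × x ∈ q)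
x∈p△q⁻ (true  ∷ p) (false ∷ q) here = inj₁ (here , λ ())
x∈p△q⁻ (false ∷ p) (true  ∷ q) here = inj₂ ((λ ()) , here)
x∈p△q⁻ (s ∷ p) (t ∷ q) (there x∈) with x∈p△q⁻ p q x∈
... | inj₁ (x∈p , x∉q) = inj₁ (there x∈p , λ { (there x∈q) → x∉q x∈q })
... | inj₂ (x∉p , x∈q) = inj₂ ((λ { (there x∈p) → x∉p x∈p }) , there x∈q)

x∈p△q⁺ : ∀ (p q : Subset n) → (x ∈ p × x ∉ q) ⊎ (x ∉ p × x ∈ q) → x ∈ p △ q
x∈p△q⁺ (true  ∷ p) (false ∷ q) (inj₁ (here , _)) = here
x∈p△q⁺ (true  ∷ p) (true  ∷ q) (inj₁ (here , x∉q)) = ⊥-elim (x∉q here)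
x∈p△q⁺ (s ∷ p) (t ∷ q) (inj₁ (there x∈p , x∉q)) = there (x∈p△q⁺ p q (inj₁ (x∈p , x∉q ∘ there)))
x∈p△q⁺ (false ∷ p) (true  ∷ q) (inj₂ (_ , here)) = here
x∈p△q⁺ (true  ∷ p) (true  ∷ q) (inj₂ (x∉p , here)) = ⊥-elim (x∉p here)
x∈p△q⁺ (s ∷ p) (t ∷ q) (inj₂ (x∉p , there x∈q)) = there (x∈p△q⁺ p q (inj₂ (x∉p ∘ there , x∈q)))

△-comm : ∀ (p q : Subset n) → p △ q ≡ q △ p
△-comm = zipWith-comm xor-comm

∁-─ : ∀ (p q : Subset n) → ∁ (p ─ q) ≡ ∁ p ∪ q
∁-─ [] [] = refl
∁-─ (true  ∷ p) (true  ∷ q) = cong (true ∷_) (∁-─ p q)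
∁-─ (false ∷ p) (true  ∷ q) = cong (true ∷_) (∁-─ p q)
∁-─ (true  ∷ p) (false ∷ q) = cong (false ∷_) (∁-─ p q)
∁-─ (false ∷ p) (false ∷ q) = cong (true ∷_) (∁-─ p q)

∁-involutive : ∀ (p : Subset n) → ∁ (∁ p) ≡ p
∁-involutive {n} = BooleanAlgebra.¬-involutive (∪-∩-booleanAlgebra n)

∁-injective : ∁ A ≡ ∁ B → A ≡ B
∁-injective {A = A} {B} ∁A≡∁B = trans (sym (∁-involutive A)) (trans (cong ∁ ∁A≡∁B) (∁-involutive B))

x∉p-x : ∀ (p : Subset n) (x : Fin n) → x ∉ p - x
x∉p-x p x = x∈∁p⇒x∉p (subst (x ∈_) (sym (∁-─ p ⁅ x ⁆)) (q⊆p∪q (∁ p) ⁅ x ⁆ (x∈⁅x⁆ x)))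

x∈upto⁻ : ∀ {b} → x ∈ upto n b → toℕ x < b
x∈upto⁻ {x = x} {b} x∈ =
  <ᵇ⇒< (toℕ x) b (Equivalence.from T-≡ (trans (sym (lookup∘tabulate _ x)) ([]=⇒lookup x∈)))

x∈upto⁺ : ∀ {b} → toℕ x < b → x ∈ upto n b
x∈upto⁺ {x = x} x<b = lookup⇒[]= x _ (trans (lookup∘tabulate _ x) (Equivalence.to T-≡ (<⇒<ᵇ x<b)))

colex-⊉ : ColexLt A B → ¬ B ⊆ A
colex-⊉ {A = A} {B} (x , (x∈A△B , _) , x∈B) B⊆A with x∈p△q⁻ A B x∈A△B
... | inj₁ (_ , x∉B) = x∉B x∈B
... | inj₂ (x∉A , _) = x∉A (B⊆A x∈B)

colex-irrefl : ¬ ColexLt A A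
colex-irrefl A<A = colex-⊉ A<A ⊆-refl

colex-asym : ColexLt A B → ¬ ColexLt B A
colex-asym {A = A} {B} (x , (x∈A△B , x-max) , x∈B) (y , (y∈B△A , y-max) , y∈A)
  with x∈p△q⁻ A B x∈A△B
... | inj₁ (_ , x∉B) = x∉B x∈B
... | inj₂ (x∉A , _) = x∉A (subst (_∈ A) (sym x≡y) y∈A)
  where
  x≡y : x ≡ y
  x≡y = toℕ-injective (≤-antisym (y-max x (subst (x ∈_) (△-comm A B) x∈A△B))
                                 (x-max y (subst (y ∈_) (△-comm B A) y∈B△A)))

colex-⊆upto : ∀ {b} → ColexLt A B → B ⊆ upto n b → A ⊆ upto n b
colex-⊆upto {A = A} {B} {b} (x , (_ , x-max) , x∈B) B⊆ {y} y∈A with y ∈? B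
... | yes y∈B = B⊆ y∈B
... | no  y∉B =
  x∈upto⁺ (≤-<-trans (x-max y (x∈p△q⁺ A B (inj₁ (y∈A , y∉B)))) (x∈upto⁻ {b = b} (B⊆ x∈B)))

colex-below-max : IsMax B m → m ∉ A → (∀ y → y ∈ A → toℕ y ≤ toℕ m) → ColexLt A B
colex-below-max {B = B} {m} {A} (m∈B , m-max) m∉A m-bounds-A =
  m , (x∈p△q⁺ A B (inj₂ (m∉A , m∈B)) , bounded) , m∈B
  where
  bounded : ∀ y → y ∈ A △ B → toℕ y ≤ toℕ m
  bounded y y∈ with x∈p△q⁻ A B y∈
  ... | inj₁ (y∈A , _) = m-bounds-A y y∈A
  ... | inj₂ (_ , y∈B) = m-max y y∈B

copy-replace : ∀ {k} {_≤P_ : Fin k → Fin k → Set} {T S : Subset n} {𝓛 𝓜 : List (Subset n)} →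
  Copy _≤P_ (T ∷ 𝓛) → S ∉ᶠ 𝓛 → 𝓛 ⊆ᶠ 𝓜 →
  (∀ {X} → X ∈ᶠ 𝓛 → (T ⊆ X → S ⊆ X) × (X ⊆ T → X ⊆ S)) → Copy _≤P_ (S ∷ 𝓜)
copy-replace {n = n} {k = k} {_≤P_} {T} {S} {𝓛} {𝓜} (ι , ι∈ , ι-inj , ι-mono) S∉𝓛 𝓛⊆𝓜 comparable =
  ι′ , ι′∈ , ι′-inj , ι′-mono
  where
  _≟ˢ_ : (X Y : Subset n) → Dec (X ≡ Y)
  _≟ˢ_ = ≡-dec _≟ᵇ_

  redirect : ∀ {X} → Dec (X ≡ T) → Subset n
  redirect (yes _) = S
  redirect {X} (no _) = X

  ι′ : Fin k → Subset n
  ι′ p = redirect (ι p ≟ˢ T)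

  ι∈𝓛 : ∀ p → ι p ≢ T → ι p ∈ᶠ 𝓛
  ι∈𝓛 p ιp≢T with ι∈ p
  ... | here ιp≡T = ⊥-elim (ιp≢T ιp≡T)
  ... | there ιp∈ = ιp∈

  ι′∈ : ∀ p → ι′ p ∈ᶠ S ∷ 𝓜
  ι′∈ p with ι p ≟ˢ T
  ... | yes _    = here refl
  ... | no ιp≢T = there (𝓛⊆𝓜 (ι∈𝓛 p ιp≢T))

  ι′-inj : ∀ p q → ι′ p ≡ ι′ q → p ≡ q
  ι′-inj p q eq with ι p ≟ˢ T | ι q ≟ˢ T
  ... | yes ιp≡T | yes ιq≡T = ι-inj p q (trans ιp≡T (sym ιq≡T))
  ... | no  _    | no  _    = ι-inj p q eq
  ... | yes _    | no ιq≢T = ⊥-elim (S∉𝓛 (subst (_∈ᶠ 𝓛) (sym eq) (ι∈𝓛 q ιq≢T)))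
  ... | no ιp≢T | yes _    = ⊥-elim (S∉𝓛 (subst (_∈ᶠ 𝓛) eq (ι∈𝓛 p ιp≢T)))

  ι′-mono : ∀ p q → p ≤P q → ι′ p ⊆ ι′ q
  ι′-mono p q p≤q with ι p ≟ˢ T | ι q ≟ˢ T | ι-mono p q p≤q
  ... | yes _    | yes _    | _      = ⊆-refl
  ... | no  _    | no  _    | ιp⊆ιq = ιp⊆ιq
  ... | yes ιp≡T | no ιq≢T | ιp⊆ιq =
    proj₁ (comparable (ι∈𝓛 q ιq≢T)) (⊆-trans (⊆-reflexive (sym ιp≡T)) ιp⊆ιq)
  ... | no ιp≢T | yes ιq≡T | ιp⊆ιq =
    proj₂ (comparable (ι∈𝓛 p ιp≢T)) (⊆-trans ιp⊆ιq (⊆-reflexive ιq≡T))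

module GreedyColexProcess {k} {_≤P_ : Fin k → Fin k → Set} {n : ℕ} {F : ℕ → Subset (suc n)}
  (enum : IsColexEnum (suc n) F) {fam : ℕ → List (Subset (suc n))} (greedy : GreedyColex _≤P_ F fam)
  where

  private
    N H : ℕ
    N = suc n
    H = half N

    G : ℕ → Subset N
    G = compl F

  private
    variable
      𝓐 𝓑 : List (Subset N)
      S X : Subset N

  step-⊆ : Step _≤P_ 𝓐 S 𝓑 → 𝓐 ⊆ᶠ 𝓑
  step-⊆ (inj₁ (_ , refl)) = there
  step-⊆ (inj₂ (_ , refl)) = λ X∈ → X∈

  step-∈ : Step _≤P_ 𝓐 S 𝓑 → X ∈ᶠ 𝓑 → X ≡ S ⊎ X ∈ᶠ 𝓐
  step-∈ (inj₁ (_ , refl)) (here X≡S) = inj₁ X≡S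
  step-∈ (inj₁ (_ , refl)) (there X∈) = inj₂ X∈
  step-∈ (inj₂ (_ , refl)) X∈        = inj₂ X∈

  step-accepts : Step _≤P_ 𝓐 S 𝓑 → Free _≤P_ (S ∷ 𝓐) → S ∈ᶠ 𝓑
  step-accepts (inj₁ (_ , refl))       _    = here refl
  step-accepts (inj₂ (not-free , _)) free = ⊥-elim (not-free free)

  step-free : Step _≤P_ 𝓐 S 𝓑 → S ∈ᶠ 𝓑 → S ∉ᶠ 𝓐 → Free _≤P_ (S ∷ 𝓐)
  step-free (inj₁ (free , _))    _   _   = free
  step-free (inj₂ (_ , refl)) S∈𝓐 S∉𝓐 = ⊥-elim (S∉𝓐 S∈𝓐)

  fam′ : ∀ i → i < H → List (Subset N)
  fam′ i i<H = proj₁ (proj₂ greedy i i<H)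

  step-F : ∀ {i} (i<H : i < H) → Step _≤P_ (fam i) (F (suc i)) (fam′ i i<H)
  step-F i<H = proj₁ (proj₂ (proj₂ greedy _ i<H))

  step-G : ∀ {i} (i<H : i < H) → Step _≤P_ (fam′ i i<H) (G (suc i)) (fam (suc i))
  step-G i<H = proj₂ (proj₂ (proj₂ greedy _ i<H))

  fam-mono : ∀ {i j} → i ≤ j → j ≤ H → fam i ⊆ᶠ fam j
  fam-mono {j = zero}  z≤n _ = λ X∈ → X∈
  fam-mono {j = suc j} i≤j j<H with m≤n⇒m<n∨m≡n i≤j
  ... | inj₂ refl       = λ X∈ → X∈
  ... | inj₁ (s≤s i≤j) = step-⊆ (step-G j<H) ∘ step-⊆ (step-F j<H) ∘ fam-mono i≤j (<⇒≤ j<H)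

  Candidate : ℕ → Subset N → Set
  Candidate l X = ∃ λ r → 1 ≤ r × r ≤ l × (X ≡ F r ⊎ X ≡ G r)

  fam-candidates : ∀ {l X} → l ≤ H → X ∈ᶠ fam l → Candidate l X
  fam-candidates {zero} _ X∈ rewrite proj₁ greedy with X∈
  ... | ()
  fam-candidates {suc l} l<H X∈ with step-∈ (step-G l<H) X∈
  ... | inj₁ X≡G = suc l , s≤s z≤n , ≤-refl , inj₂ X≡G
  ... | inj₂ X∈fam′ with step-∈ (step-F l<H) X∈fam′
  ...   | inj₁ X≡F = suc l , s≤s z≤n , ≤-refl , inj₁ X≡F
  ...   | inj₂ X∈fam with fam-candidates (<⇒≤ l<H) X∈fam
  ...     | r , r₁ , r≤l , X≡ = r , r₁ , m≤n⇒m≤1+n r≤l , X≡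

  F-avoids-top : ∀ {r} → 1 ≤ r → r ≤ H → AvoidsTop (F r)
  F-avoids-top = proj₁ enum _

  colex-ordered : ∀ {a b} → 1 ≤ a → a < b → b ≤ H → ColexLt (F a) (F b)
  colex-ordered = proj₁ (proj₂ enum) _ _

  F-surjective : ∀ {T} → AvoidsTop T → ∃ λ j → 1 ≤ j × j ≤ H × F j ≡ T
  F-surjective = proj₂ (proj₂ enum) _

  F≢G : ∀ {r s} → 1 ≤ r → r ≤ H → 1 ≤ s → s ≤ H → F r ≢ G s
  F≢G r₁ rH s₁ sH Fr≡Gs =
    F-avoids-top r₁ rH top top-is-n (subst (top ∈_) (sym Fr≡Gs) (x∉p⇒x∈∁p (F-avoids-top s₁ sH top top-is-n)))
    where
    top : Fin N
    top = fromℕ n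
    top-is-n : suc (toℕ top) ≡ N
    top-is-n = cong suc (toℕ-fromℕ n)

  index-< : ∀ {a b} → 1 ≤ a → a ≤ H → 1 ≤ b → b ≤ H → ColexLt (F a) (F b) → a < b
  index-< {a} {b} a₁ aH b₁ bH Fa<Fb with <-cmp a b
  ... | tri< a<b _ _ = a<b
  ... | tri≈ _ refl _ = ⊥-elim (colex-irrefl Fa<Fb)
  ... | tri> _ _ b<a = ⊥-elim (colex-asym Fa<Fb (colex-ordered b₁ b<a aH))

  F-injective : ∀ {a b} → 1 ≤ a → a ≤ H → 1 ≤ b → b ≤ H → F a ≡ F b → a ≡ b
  F-injective {a} {b} a₁ aH b₁ bH Fa≡Fb with <-cmp a b
  ... | tri< a<b _ _ = ⊥-elim (colex-irrefl (subst (ColexLt (F a)) (sym Fa≡Fb) (colex-ordered a₁ a<b bH)))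
  ... | tri≈ _ a≡b _ = a≡b
  ... | tri> _ _ b<a = ⊥-elim (colex-irrefl (subst (ColexLt (F b)) Fa≡Fb (colex-ordered b₁ b<a aH)))

  candidate-new : ∀ {i l X} → 1 ≤ i → i ≤ H → l < i → Candidate l X → X ≢ F i × X ≢ G i
  candidate-new {i} {X = X} i₁ iH l<i (r , r₁ , r≤l , X≡) = distinct X≡
    where
    r<i : r < i
    r<i = ≤-<-trans r≤l l<i
    rH : r ≤ H
    rH = ≤-trans (<⇒≤ r<i) iH
    distinct : X ≡ F r ⊎ X ≡ G r → X ≢ F i × X ≢ G i
    distinct (inj₁ X≡Fr) =
      (λ X≡Fi → <⇒≢ r<i (F-injective r₁ rH i₁ iH (trans (sym X≡Fr) X≡Fi))) ,
      (λ X≡Gi → F≢G r₁ rH i₁ iH (trans (sym X≡Fr) X≡Gi))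
    distinct (inj₂ X≡Gr) =
      (λ X≡Fi → F≢G i₁ iH r₁ rH (trans (sym X≡Fi) X≡Gr)) ,
      (λ X≡Gi → <⇒≢ r<i (F-injective r₁ rH i₁ iH (∁-injective (trans (sym X≡Gr) X≡Gi))))

  F∉fam : ∀ {i l} → 1 ≤ i → i ≤ H → l < i → F i ∉ᶠ fam l
  F∉fam i₁ iH l<i Fᵢ∈ = proj₁ (candidate-new i₁ iH l<i (fam-candidates (≤-trans (<⇒≤ l<i) iH) Fᵢ∈)) refl

  G∉fam : ∀ {i l} → 1 ≤ i → i ≤ H → l < i → G i ∉ᶠ fam l
  G∉fam i₁ iH l<i Gᵢ∈ = proj₂ (candidate-new i₁ iH l<i (fam-candidates (≤-trans (<⇒≤ l<i) iH) Gᵢ∈)) refl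

  F-accepted : ∀ {i} (i<H : i < H) → Free _≤P_ (F (suc i) ∷ fam i) → F (suc i) ∈ᶠ fam (suc i)
  F-accepted i<H free = step-⊆ (step-G i<H) (step-accepts (step-F i<H) free)

  G-accepted : ∀ {i} (i<H : i < H) → Free _≤P_ (G (suc i) ∷ fam′ i i<H) → G (suc i) ∈ᶠ fam (suc i)
  G-accepted i<H = step-accepts (step-G i<H)

  -- F (l+1) is tested against fam l and G (l+1) against fam′ l; both contain fam l.
  Admitted : Subset N → ℕ → Set
  Admitted S l = S ∉ᶠ fam l × Σ (List (Subset N)) λ 𝓑 → fam l ⊆ᶠ 𝓑 × Free _≤P_ (S ∷ 𝓑)

  F-admitted : ∀ {i} → i < H → F (suc i) ∈ᶠ fam (suc i) → Admitted (F (suc i)) i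
  F-admitted i<H Fᵢ∈ = F∉fam (s≤s z≤n) i<H ≤-refl , fam _ , (λ X∈ → X∈) ,
    step-free (step-F i<H) Fᵢ∈fam′ (F∉fam (s≤s z≤n) i<H ≤-refl)
    where
    Fᵢ∈fam′ : F _ ∈ᶠ fam′ _ i<H
    Fᵢ∈fam′ with step-∈ (step-G i<H) Fᵢ∈
    ... | inj₁ Fᵢ≡Gᵢ = ⊥-elim (F≢G (s≤s z≤n) i<H (s≤s z≤n) i<H Fᵢ≡Gᵢ)
    ... | inj₂ Fᵢ∈′  = Fᵢ∈′

  G-admitted : ∀ {i} → i < H → G (suc i) ∈ᶠ fam (suc i) → Admitted (G (suc i)) i
  G-admitted i<H Gᵢ∈ = G∉fam (s≤s z≤n) i<H ≤-refl , fam′ _ i<H , step-⊆ (step-F i<H) ,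
    step-free (step-G i<H) Gᵢ∈ Gᵢ∉fam′
    where
    Gᵢ∉fam′ : G _ ∉ᶠ fam′ _ i<H
    Gᵢ∉fam′ Gᵢ∈′ with step-∈ (step-F i<H) Gᵢ∈′
    ... | inj₁ Gᵢ≡Fᵢ = F≢G (s≤s z≤n) i<H (s≤s z≤n) i<H (sym Gᵢ≡Fᵢ)
    ... | inj₂ Gᵢ∈   = G∉fam (s≤s z≤n) i<H ≤-refl Gᵢ∈

  F-kept : ∀ {S T l} j → F (suc j) ≡ T → j < l → l ≤ H → Admitted S l → T ⊆ S →
    (∀ {r} → 1 ≤ r → r ≤ j → T ⊆ G r → S ⊆ G r) → T ∈ᶠ fam (suc j)
  F-kept {S} j refl j<l lH (S∉ , 𝓑 , fam⊆𝓑 , free) T⊆S above =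
    F-accepted j<H λ copy → free (copy-replace copy (S∉ ∘ famj⊆faml) (fam⊆𝓑 ∘ famj⊆faml) comparable)
    where
    j<H : j < H
    j<H = ≤-trans j<l lH
    famj⊆faml : fam j ⊆ᶠ fam _
    famj⊆faml = fam-mono (<⇒≤ j<l) lH
    upward : ∀ {X} → X ∈ᶠ fam j → F (suc j) ⊆ X → S ⊆ X
    upward X∈ with fam-candidates (<⇒≤ j<H) X∈
    ... | r , r₁ , r≤j , inj₁ refl = ⊥-elim ∘ colex-⊉ (colex-ordered r₁ (s≤s r≤j) j<H)
    ... | r , r₁ , r≤j , inj₂ refl = above r₁ r≤j
    comparable : ∀ {X} → X ∈ᶠ fam j → (F (suc j) ⊆ X → S ⊆ X) × (X ⊆ F (suc j) → X ⊆ S)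
    comparable X∈ = upward X∈ , λ X⊆T → ⊆-trans X⊆T T⊆S

  G-kept : ∀ {S T l} j → G (suc j) ≡ T → j < l → l ≤ H → Admitted S l → S ⊆ T →
    (∀ {r} → 1 ≤ r → r ≤ suc j → F r ⊆ T → F r ⊆ S) → T ∈ᶠ fam (suc j)
  G-kept {S} j refl j<l lH (S∉ , 𝓑 , fam⊆𝓑 , free) S⊆T below =
    G-accepted j<H λ copy → free (copy-replace copy (S∉ ∘ fam′⊆faml) (fam⊆𝓑 ∘ fam′⊆faml) comparable)
    where
    j<H : j < H
    j<H = ≤-trans j<l lH
    fam′⊆faml : fam′ j j<H ⊆ᶠ fam _
    fam′⊆faml = fam-mono j<l lH ∘ step-⊆ (step-G j<H)
    downward : ∀ {X} → X ∈ᶠ fam′ j j<H → X ⊆ G (suc j) → X ⊆ S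
    downward X∈ with step-∈ (step-F j<H) X∈
    ... | inj₁ refl = below (s≤s z≤n) ≤-refl
    ... | inj₂ X∈fam with fam-candidates (<⇒≤ j<H) X∈fam
    ...   | r , r₁ , r≤j , inj₁ refl = below r₁ (m≤n⇒m≤1+n r≤j)
    ...   | r , r₁ , r≤j , inj₂ refl =
      λ Gr⊆Gj → ⊥-elim (colex-⊉ (colex-ordered r₁ (s≤s r≤j) j<H) (∁p⊆∁q⇒p⊇q Gr⊆Gj))
    comparable : ∀ {X} → X ∈ᶠ fam′ j j<H → (G (suc j) ⊆ X → S ⊆ X) × (X ⊆ G (suc j) → X ⊆ S)
    comparable X∈ = ⊆-trans S⊆T , downward X∈

  F-⊆upto : ∀ {r j b} → 1 ≤ r → r ≤ j → j ≤ H → F j ⊆ upto N b → F r ⊆ upto N b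
  F-⊆upto {b = b} r₁ r≤j jH Fj⊆ with m≤n⇒m<n∨m≡n r≤j
  ... | inj₁ r<j = colex-⊆upto {b = b} (colex-ordered r₁ r<j jH) Fj⊆
  ... | inj₂ refl = Fj⊆

  earlier-index : ∀ {T i} → AvoidsTop T → 1 ≤ i → i ≤ H → ColexLt T (F i) →
    ∃ λ j → suc j < i × F (suc j) ≡ T
  earlier-index T-avoids i₁ iH T<Fi with F-surjective T-avoids
  ... | zero  , ()  , _
  ... | suc j , j₁ , jH , refl = j , index-< j₁ jH i₁ iH T<Fi , refl

module EarlierSets {k} {_≤P_ : Fin k → Fin k → Set} {n : ℕ} {F : ℕ → Subset (suc n)}
  (enum : IsColexEnum (suc n) F) {fam : ℕ → List (Subset (suc n))} (greedy : GreedyColex _≤P_ F fam)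
  {i : ℕ} (i<H : i < half (suc n)) {m : Fin (suc n)} (m-max : IsMax (F (suc i)) m)
  where

  open GreedyColexProcess enum greedy
  open ≡-Reasoning

  private
    N : ℕ
    N = suc n

    Fᵢ Gᵢ U : Subset N
    Fᵢ = F (suc i)
    Gᵢ = compl F (suc i)
    U  = upto N (suc (toℕ m))

    m∈Fᵢ : m ∈ Fᵢ
    m∈Fᵢ = proj₁ m-max

    1≤suc-i : 1 ≤ suc i
    1≤suc-i = s≤s z≤n

  U-avoids-top : AvoidsTop U
  U-avoids-top x x-top x∈U = F-avoids-top 1≤suc-i i<H x x-top (subst (_∈ Fᵢ) (sym x≡m) m∈Fᵢ)
    where
    x≡m : x ≡ m
    x≡m = toℕ-injective (≤-antisym (≤-pred (x∈upto⁻ x∈U))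
                                   (≤-pred (subst (toℕ m <_) (sym x-top) (toℕ<n m))))

  Fᵢ-m⊆upto-m : Fᵢ - m ⊆ upto N (toℕ m)
  Fᵢ-m⊆upto-m {y} y∈ = x∈upto⁺ (≤∧≢⇒< (proj₂ m-max y (p─q⊆p Fᵢ ⁅ m ⁆ y∈)) y≢m)
    where
    y≢m : toℕ y ≢ toℕ m
    y≢m y≡m = x∉p-x Fᵢ m (subst (_∈ Fᵢ - m) (toℕ-injective y≡m) y∈)

  Fᵢ-m-index : ∃ λ j → suc j < suc i × F (suc j) ≡ Fᵢ - m
  Fᵢ-m-index = earlier-index avoids 1≤suc-i i<H (colex-below-max m-max (x∉p-x Fᵢ m) bounded)
    where
    avoids : AvoidsTop (Fᵢ - m)
    avoids x x-top = F-avoids-top 1≤suc-i i<H x x-top ∘ p─q⊆p Fᵢ ⁅ m ⁆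
    bounded : ∀ y → y ∈ Fᵢ - m → toℕ y ≤ toℕ m
    bounded y = <⇒≤ ∘ x∈upto⁻ ∘ Fᵢ-m⊆upto-m

  Gᵢ∩U-index : ∃ λ j → suc j < suc i × F (suc j) ≡ Gᵢ ∩ U
  Gᵢ∩U-index = earlier-index avoids 1≤suc-i i<H (colex-below-max m-max m∉ bounded)
    where
    avoids : AvoidsTop (Gᵢ ∩ U)
    avoids x x-top = U-avoids-top x x-top ∘ p∩q⊆q Gᵢ U
    m∉ : m ∉ Gᵢ ∩ U
    m∉ m∈ = x∈∁p⇒x∉p (p∩q⊆p Gᵢ U m∈) m∈Fᵢ
    bounded : ∀ y → y ∈ Gᵢ ∩ U → toℕ y ≤ toℕ m
    bounded y = ≤-pred ∘ x∈upto⁻ ∘ p∩q⊆q Gᵢ U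

  F-below-m : ∀ {j r} → F (suc j) ≡ Fᵢ - m → suc j < suc i → 1 ≤ r → r ≤ suc j → F r ⊆ upto N (toℕ m)
  F-below-m Fj≡ j<i r₁ r≤j =
    F-⊆upto {b = toℕ m} r₁ r≤j (≤-trans (<⇒≤ j<i) i<H) (⊆-trans (⊆-reflexive Fj≡) Fᵢ-m⊆upto-m)

  F-⊆U : ∀ {j r} → F (suc j) ≡ Gᵢ ∩ U → suc j < suc i → 1 ≤ r → r ≤ suc j → F r ⊆ U
  F-⊆U Fj≡ j<i r₁ r≤j =
    F-⊆upto {b = suc (toℕ m)} r₁ r≤j (≤-trans (<⇒≤ j<i) i<H)
                              (⊆-trans (⊆-reflexive Fj≡) (p∩q⊆q Gᵢ U))

  Fᵢ-m-earlier : Fᵢ ∈ᶠ fam (suc i) → ∃ λ j → j < suc i × (Fᵢ - m) ∈ᶠ fam j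
  Fᵢ-m-earlier Fᵢ∈ with Fᵢ-m-index
  ... | j , j<i , Fj≡ =
    suc j , j<i , F-kept j Fj≡ (≤-pred j<i) (<⇒≤ i<H) (F-admitted i<H Fᵢ∈) (p─q⊆p Fᵢ ⁅ m ⁆) covers
    where
    covers : ∀ {r} → 1 ≤ r → r ≤ j → Fᵢ - m ⊆ compl F r → Fᵢ ⊆ compl F r
    covers r₁ r≤j Fᵢ-m⊆Gr {y} y∈ with y ≟ᶠ m
    ... | no  y≢m = Fᵢ-m⊆Gr (x∈p∧x≢y⇒x∈p-y y∈ y≢m)
    ... | yes refl = x∉p⇒x∈∁p λ m∈Fr →
      <-irrefl refl (x∈upto⁻ (F-below-m Fj≡ j<i r₁ (m≤n⇒m≤1+n r≤j) m∈Fr))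

  Fᵢ∪∁U-earlier : Fᵢ ∈ᶠ fam (suc i) → ∃ λ j → j < suc i × (Fᵢ ∪ ∁ U) ∈ᶠ fam j
  Fᵢ∪∁U-earlier Fᵢ∈ with Gᵢ∩U-index
  ... | j , j<i , Fj≡ =
    suc j , j<i , G-kept j Gj≡ (≤-pred j<i) (<⇒≤ i<H) (F-admitted i<H Fᵢ∈) (p⊆p∪q (∁ U)) covered
    where
    Gj≡ : compl F (suc j) ≡ Fᵢ ∪ ∁ U
    Gj≡ = begin
      ∁ (F (suc j))   ≡⟨ cong ∁ Fj≡ ⟩
      ∁ (∁ Fᵢ ∩ U)    ≡⟨ BooleanAlgebra.deMorgan₁ (∪-∩-booleanAlgebra N) (∁ Fᵢ) U ⟩
      ∁ (∁ Fᵢ) ∪ ∁ U  ≡⟨ cong (_∪ ∁ U) (∁-involutive Fᵢ) ⟩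
      Fᵢ ∪ ∁ U        ∎
    covered : ∀ {r} → 1 ≤ r → r ≤ suc j → F r ⊆ Fᵢ ∪ ∁ U → F r ⊆ Fᵢ
    covered r₁ r≤j Fr⊆ {y} y∈Fr with x∈p∪q⁻ Fᵢ (∁ U) (Fr⊆ y∈Fr)
    ... | inj₁ y∈Fᵢ = y∈Fᵢ
    ... | inj₂ y∈∁U =
      ⊥-elim (x∈∁p⇒x∉p y∈∁U (F-⊆U Fj≡ j<i r₁ r≤j y∈Fr))

  Gᵢ∪m-earlier : Gᵢ ∈ᶠ fam (suc i) → ∃ λ j → j < suc i × (Gᵢ ∪ ⁅ m ⁆) ∈ᶠ fam j
  Gᵢ∪m-earlier Gᵢ∈ with Fᵢ-m-index
  ... | j , j<i , Fj≡ =
    suc j , j<i , G-kept j Gj≡ (≤-pred j<i) (<⇒≤ i<H) (G-admitted i<H Gᵢ∈) (p⊆p∪q ⁅ m ⁆) covered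
    where
    Gj≡ : compl F (suc j) ≡ Gᵢ ∪ ⁅ m ⁆
    Gj≡ = trans (cong ∁ Fj≡) (∁-─ Fᵢ ⁅ m ⁆)
    covered : ∀ {r} → 1 ≤ r → r ≤ suc j → F r ⊆ Gᵢ ∪ ⁅ m ⁆ → F r ⊆ Gᵢ
    covered r₁ r≤j Fr⊆ {y} y∈Fr with x∈p∪q⁻ Gᵢ ⁅ m ⁆ (Fr⊆ y∈Fr)
    ... | inj₁ y∈Gᵢ = y∈Gᵢ
    ... | inj₂ y∈⁅m⁆ with x∈⁅y⁆⇒x≡y m y∈⁅m⁆
    ...   | refl =
      ⊥-elim (<-irrefl refl (x∈upto⁻ (F-below-m Fj≡ j<i r₁ r≤j y∈Fr)))

  Gᵢ∩U-earlier : Gᵢ ∈ᶠ fam (suc i) → ∃ λ j → j < suc i × (Gᵢ ∩ U) ∈ᶠ fam j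
  Gᵢ∩U-earlier Gᵢ∈ with Gᵢ∩U-index
  ... | j , j<i , Fj≡ =
    suc j , j<i , F-kept j Fj≡ (≤-pred j<i) (<⇒≤ i<H) (G-admitted i<H Gᵢ∈) (p∩q⊆p Gᵢ U) covers
    where
    covers : ∀ {r} → 1 ≤ r → r ≤ j → Gᵢ ∩ U ⊆ compl F r → Gᵢ ⊆ compl F r
    covers r₁ r≤j Gᵢ∩U⊆Gr {y} y∈Gᵢ = x∉p⇒x∈∁p λ y∈Fr →
      x∈∁p⇒x∉p (Gᵢ∩U⊆Gr (x∈p∩q⁺ (y∈Gᵢ , F-⊆U Fj≡ j<i r₁ (m≤n⇒m≤1+n r≤j) y∈Fr))) y∈Fr

lemma8 : ∀ {k} (_≤P_ : Fin k → Fin k → Set) → IsPartialOrder _≡_ _≤P_ →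
    ∀ n → 2 ≤ n → (F : ℕ → Subset n) → IsColexEnum n F →
    (fam : ℕ → List (Subset n)) → GreedyColex _≤P_ F fam →
    ∀ i → 2 ≤ i → i ≤ half n → (m : Fin n) → IsMax (F i) m →
      (F i ∈ᶠ fam i → ∃ λ j → j < i × (F i - m) ∈ᶠ fam j)
      × (F i ∈ᶠ fam i → ∃ λ j → j < i × (F i ∪ ∁ (upto n (suc (toℕ m)))) ∈ᶠ fam j)
      × (compl F i ∈ᶠ fam i → ∃ λ j → j < i × (compl F i ∪ ⁅ m ⁆) ∈ᶠ fam j)
      × (compl F i ∈ᶠ fam i → ∃ λ j → j < i × (compl F i ∩ upto n (suc (toℕ m))) ∈ᶠ fam j)
lemma8 _ _ (suc n) _ F enum fam greedy (suc i) _ i<H m m-max =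
  Fᵢ-m-earlier , Fᵢ∪∁U-earlier , Gᵢ∪m-earlier , Gᵢ∩U-earlier
  where open EarlierSets enum greedy i<H m-max
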